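{- Let $Q$ be a quiver on nodes $1,\dots,N$ with skew-symmetric matrix $B_Q$, and suppose node $1$ is a sink of $Q$. Then $Q$ has period $1$, i.e. $\mu_1 B_Q=\rho B_Q\rho^{ -1}$, if and only if $\tau B_Q\tau^{ -1}=B_Q$.
   Context: A quiver on nodes $1,\dots,N$ (no loops, no $2$-cycles) is identified with the skew-symmetric integer matrix $B=(b_{ij})$, where $b_{ij}$ is the number of arrows $i\to j$ minus the number of arrows $j\to i$. The mutation at node $k$ is $\mu_k B=\tilde B$ with $\tilde b_{ij}=-b_{ij}$ if $i=k$ or $j=k$, and $\tilde b_{ij}=b_{ij}+\frac12(|b_{ik}|b_{kj}+b_{ik}|b_{kj}|)$ otherwise. $\rho$ is the $N\times N$ permutation matrix with $\rho_{i+1,i}=1$ for $1\le i\le N-1$, $\rho_{1,N}=1$ and all other entries $0$ (so $(\rho B\rho^{ -1})_{ij}=b_{i-1,j-1}$, indices mod $N$). $\tau$ is the $N\times N$ matrix with $\tau_{i+1,i}=1$ for $1\le i\le N-1$, $\tau_{1,N}=-1$ and all other entries $0$. Node $i$ is a sink if all arrows incident with $i$ end at $i$, i.e. $b_{ij}\le 0$ for all $j$. -}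

module Defs where

open import Data.Nat as ℕ using (ℕ; zero; suc)
open import Data.Fin using (Fin; toℕ; fromℕ; zero)
open import Data.Fin.Properties using (_≟_)
open import Data.Integer using (ℤ; 0ℤ; 1ℤ; -_; _+_; _*_; _≤_; ∣_∣; +_)
open import Data.Integer.DivMod using (_/_)
open import Data.Bool using (Bool; true; false; if_then_else_)
open import Relation.Nullary.Decidable using (⌊_⌋)
open import Relation.Binary.PropositionalEquality using (_≡_)

-- Square integer matrices on nodes Fin N (Fin index i corresponds to node i+1).
Mat : ℕ → Set
Mat N = Fin N → Fin N → ℤ

SkewSymmetric : ∀ {N} → Mat N → Set
SkewSymmetric {N} B = ∀ (i j : Fin N) → B j i ≡ - B i j

_≐_ : ∀ {N} → Mat N → Mat N → Set
_≐_ {N} A B = ∀ (i j : Fin N) → A i j ≡ B i j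

infix 4 _≐_

sumFin : ∀ n → (Fin n → ℤ) → ℤ
sumFin zero    f = 0ℤ
sumFin (suc n) f = f zero + sumFin n (λ i → f (Data.Fin.suc i))

_⊗_ : ∀ {N} → Mat N → Mat N → Mat N
_⊗_ {N} A B i j = sumFin N (λ k → A i k * B k j)

infixl 7 _⊗_

transpose : ∀ {N} → Mat N → Mat N
transpose A i j = A j i

-- Nodes are Fin (suc n) with N = suc n; node 1 is Fin.zero, node N is fromℕ n.
-- Mutation at node k.
mutate : ∀ {N} → Fin N → Mat N → Mat N
mutate k B i j =
  if ⌊ i ≟ k ⌋ then - B i j
  else if ⌊ j ≟ k ⌋ then - B i j
  else B i j + ((+ ∣ B i k ∣) * B k j + B i k * (+ ∣ B k j ∣)) / (+ 2)

ρ : ∀ n → Mat (suc n)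
ρ n r c =
  if ⌊ toℕ r ℕ.≟ suc (toℕ c) ⌋ then 1ℤ
  else if ⌊ r ≟ zero ⌋ then (if ⌊ c ≟ fromℕ n ⌋ then 1ℤ else 0ℤ)
  else 0ℤ

τ : ∀ n → Mat (suc n)
τ n r c =
  if ⌊ toℕ r ℕ.≟ suc (toℕ c) ⌋ then 1ℤ
  else if ⌊ r ≟ zero ⌋ then (if ⌊ c ≟ fromℕ n ⌋ then - 1ℤ else 0ℤ)
  else 0ℤ

-- ρ and τ are signed permutation matrices, so their inverses are their transposes.
ρ⁻¹ : ∀ n → Mat (suc n)
ρ⁻¹ n = transpose (ρ n)

τ⁻¹ : ∀ n → Mat (suc n)
τ⁻¹ n = transpose (τ n)

IsSink : ∀ {N} → Mat N → Fin N → Set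
IsSink {N} B i = ∀ (j : Fin N) → B i j ≤ 0ℤ

-- Conjugation by ρ relabels the nodes cyclically (b_ij ↦ b_{i-1,j-1}), and conjugation by τ
-- does the same and then reverses every arrow at node 1.  Because node 1 is a sink, the
-- correction term ½(|b_i1| b_1j + b_i1 |b_1j|) of the mutation rule vanishes, so μ₁ merely
-- reverses the arrows at node 1.  With S = diag(-1, 1, …, 1) this reads μ₁ B = S B S and
-- τ B τ⁻¹ = S (ρ B ρ⁻¹) S; as S is an involution, S B S = ρ B ρ⁻¹ iff S (ρ B ρ⁻¹) S = B.
module Submission where

open import Defs
open import Data.Nat using (ℕ; suc)
open import Data.Fin using (Fin; zero)
open import Data.Product using (_×_; _,_)

open import Data.Nat as ℕ using ()
import Data.Nat.Properties as NP
open import Data.Fin as F using (toℕ; fromℕ; inject₁)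
open import Data.Fin.Properties using (_≟_; toℕ-inject₁; toℕ-injective; suc-injective)
open import Data.Integer using (ℤ; 0ℤ; 1ℤ; -_; _+_; _*_; ∣_∣; +_; -[1+_]; _≤_)
open import Data.Integer.DivMod using (_/_)
open import Data.Integer.Properties hiding (_≟_)
open import Data.Integer.Tactic.RingSolver using (solve-∀)
open import Data.Bool using (if_then_else_)
open import Function using (_∘_)
open import Data.Empty using (⊥-elim)
open import Relation.Nullary using (yes; no)
open import Relation.Nullary.Decidable using (⌊_⌋)
open import Relation.Binary.PropositionalEquality

sumFin-zero : ∀ n (f : Fin n → ℤ) → (∀ k → f k ≡ 0ℤ) → sumFin n f ≡ 0ℤ
sumFin-zero ℕ.zero    f f≡0 = refl
sumFin-zero (suc n) f f≡0
  rewrite f≡0 zero | sumFin-zero n (λ k → f (F.suc k)) (λ k → f≡0 (F.suc k)) = refl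

sumFin-single : ∀ n (f : Fin n → ℤ) p → (∀ k → k ≢ p → f k ≡ 0ℤ) → sumFin n f ≡ f p
sumFin-single (suc n) f zero f≡0
  rewrite sumFin-zero n (λ k → f (F.suc k)) (λ k → f≡0 (F.suc k) λ ()) = +-identityʳ (f zero)
sumFin-single (suc n) f (F.suc p) f≡0
  rewrite f≡0 zero (λ ())
        | sumFin-single n (λ k → f (F.suc k)) p (λ k k≢p → f≡0 (F.suc k) (k≢p ∘ suc-injective))
  = +-identityˡ (f (F.suc p))

cyclicPred : ∀ {n} → Fin (suc n) → Fin (suc n)
cyclicPred {n} zero = fromℕ n
cyclicPred (F.suc r) = inject₁ r

scaleAt : ∀ {N} → ℤ → Fin N → Fin N → ℤ
scaleAt v k i = if ⌊ i ≟ k ⌋ then v else 1ℤ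

scaleAt-1 : ∀ {N} (k i : Fin N) → scaleAt 1ℤ k i ≡ 1ℤ
scaleAt-1 k i with i ≟ k
... | yes _ = refl
... | no  _ = refl

scaleAt-square : ∀ {N} {v} (k i : Fin N) → v * v ≡ 1ℤ → scaleAt v k i * scaleAt v k i ≡ 1ℤ
scaleAt-square k i v²≡1 with i ≟ k
... | yes _ = v²≡1
... | no  _ = refl

-- ρ n and τ n are definitionally signedShift n 1ℤ and signedShift n (- 1ℤ).
signedShift : ∀ n → ℤ → Mat (suc n)
signedShift n v r c =
  if ⌊ toℕ r ℕ.≟ suc (toℕ c) ⌋ then 1ℤ
  else if ⌊ r ≟ zero ⌋ then (if ⌊ c ≟ fromℕ n ⌋ then v else 0ℤ)
  else 0ℤ

signedShift-off : ∀ n v r c → c ≢ cyclicPred r → signedShift n v r c ≡ 0ℤ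
signedShift-off n v zero c c≢pred with c ≟ fromℕ n
... | yes c≡last = ⊥-elim (c≢pred c≡last)
... | no  _      = refl
signedShift-off n v (F.suc r) c c≢pred with toℕ (F.suc r) ℕ.≟ suc (toℕ c)
... | yes r≡c = ⊥-elim (c≢pred (toℕ-injective (trans (sym (NP.suc-injective r≡c)) (sym (toℕ-inject₁ r)))))
... | no  _   = refl

signedShift-on : ∀ n v r → signedShift n v r (cyclicPred r) ≡ scaleAt v zero r
signedShift-on n v zero with fromℕ n ≟ fromℕ n
... | yes _  = refl
... | no  ≢  = ⊥-elim (≢ refl)
signedShift-on n v (F.suc r) with toℕ (F.suc r) ℕ.≟ suc (toℕ (inject₁ r))
... | yes _ = refl
... | no  ≢ = ⊥-elim (≢ (cong suc (sym (toℕ-inject₁ r))))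

signedShift-*ʳ : ∀ n v (A : Mat (suc n)) i j →
  (A ⊗ transpose (signedShift n v)) i j ≡ A i (cyclicPred j) * scaleAt v zero j
signedShift-*ʳ n v A i j = begin
  sumFin (suc n) (λ k → A i k * signedShift n v j k)
    ≡⟨ sumFin-single (suc n) _ (cyclicPred j) (λ k k≢pred →
         trans (cong (A i k *_) (signedShift-off n v j k k≢pred)) (*-zeroʳ (A i k))) ⟩
  A i (cyclicPred j) * signedShift n v j (cyclicPred j)
    ≡⟨ cong (A i (cyclicPred j) *_) (signedShift-on n v j) ⟩
  A i (cyclicPred j) * scaleAt v zero j ∎
  where open ≡-Reasoning

signedShift-*ˡ : ∀ n v (A : Mat (suc n)) i j →
  (signedShift n v ⊗ A) i j ≡ scaleAt v zero i * A (cyclicPred i) j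
signedShift-*ˡ n v A i j = begin
  sumFin (suc n) (λ k → signedShift n v i k * A k j)
    ≡⟨ sumFin-single (suc n) _ (cyclicPred i) (λ k k≢pred →
         trans (cong (_* A k j) (signedShift-off n v i k k≢pred)) (*-zeroˡ (A k j))) ⟩
  signedShift n v i (cyclicPred i) * A (cyclicPred i) j
    ≡⟨ cong (_* A (cyclicPred i) j) (signedShift-on n v i) ⟩
  scaleAt v zero i * A (cyclicPred i) j ∎
  where open ≡-Reasoning

signedShift-conj : ∀ n v (B : Mat (suc n)) i j →
  (signedShift n v ⊗ B ⊗ transpose (signedShift n v)) i j
    ≡ (scaleAt v zero i * B (cyclicPred i) (cyclicPred j)) * scaleAt v zero j
signedShift-conj n v B i j =
  trans (signedShift-*ʳ n v (signedShift n v ⊗ B) i j)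
        (cong (_* scaleAt v zero j) (signedShift-*ˡ n v B i (cyclicPred j)))

ρ-conj : ∀ n (B : Mat (suc n)) i j → (ρ n ⊗ B ⊗ ρ⁻¹ n) i j ≡ B (cyclicPred i) (cyclicPred j)
ρ-conj n B i j = begin
  (ρ n ⊗ B ⊗ ρ⁻¹ n) i j
    ≡⟨ signedShift-conj n 1ℤ B i j ⟩
  (scaleAt 1ℤ zero i * B (cyclicPred i) (cyclicPred j)) * scaleAt 1ℤ zero j
    ≡⟨ cong₂ (λ s t → (s * B (cyclicPred i) (cyclicPred j)) * t) (scaleAt-1 zero i) (scaleAt-1 zero j) ⟩
  (1ℤ * B (cyclicPred i) (cyclicPred j)) * 1ℤ
    ≡⟨ trans (*-identityʳ _) (*-identityˡ _) ⟩
  B (cyclicPred i) (cyclicPred j) ∎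
  where open ≡-Reasoning

τ-conj : ∀ n (B : Mat (suc n)) i j →
  (τ n ⊗ B ⊗ τ⁻¹ n) i j ≡ (scaleAt (- 1ℤ) zero i * B (cyclicPred i) (cyclicPred j)) * scaleAt (- 1ℤ) zero j
τ-conj n = signedShift-conj n (- 1ℤ)

skew⇒diagonal≡0 : ∀ {N} {B : Mat N} → SkewSymmetric B → ∀ k → B k k ≡ 0ℤ
skew⇒diagonal≡0 {B = B} skew k with B k k | skew k k
... | + ℕ.zero | _ = refl
... | + suc _  | ()
... | -[1+ _ ] | ()

mutationTerm-vanishes : ∀ a b → 0ℤ ≤ a → b ≤ 0ℤ → (+ ∣ a ∣) * b + a * (+ ∣ b ∣) ≡ 0ℤ
mutationTerm-vanishes a b 0≤a b≤0 = begin
  (+ ∣ a ∣) * b + a * (+ ∣ b ∣)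
    ≡⟨ cong₂ (λ s t → s * b + a * t) (0≤i⇒+∣i∣≡i 0≤a)
             (trans (cong +_ (sym (∣-i∣≡∣i∣ b))) (0≤i⇒+∣i∣≡i (neg-mono-≤ b≤0))) ⟩
  a * b + a * (- b)
    ≡⟨ sym (*-distribˡ-+ a b (- b)) ⟩
  a * (b + - b)
    ≡⟨ cong (a *_) (+-inverseʳ b) ⟩
  a * 0ℤ
    ≡⟨ *-zeroʳ a ⟩
  0ℤ ∎
  where open ≡-Reasoning

mutate-sink : ∀ {N} (B : Mat N) k → SkewSymmetric B → IsSink B k → ∀ i j →
  mutate k B i j ≡ (scaleAt (- 1ℤ) k i * B i j) * scaleAt (- 1ℤ) k j
mutate-sink B k skew sink i j with i ≟ k | j ≟ k
... | yes refl | yes refl =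
  trans (cong -_ (skew⇒diagonal≡0 skew k)) (sym (cong (λ b → (- 1ℤ * b) * - 1ℤ) (skew⇒diagonal≡0 skew k)))
... | yes _ | no _ = sym (trans (*-identityʳ _) (-1*i≡-i (B i j)))
... | no _ | yes _ = sym (trans (cong (_* - 1ℤ) (*-identityˡ (B i j))) (trans (*-comm (B i j) (- 1ℤ)) (-1*i≡-i (B i j))))
... | no _ | no _ = begin
  B i j + ((+ ∣ B i k ∣) * B k j + B i k * (+ ∣ B k j ∣)) / (+ 2)
    ≡⟨ cong (λ t → B i j + t / (+ 2))
            (mutationTerm-vanishes (B i k) (B k j) 0≤Bik (sink j)) ⟩
  B i j + 0ℤ
    ≡⟨ +-identityʳ (B i j) ⟩
  B i j
    ≡⟨ sym (trans (*-identityʳ _) (*-identityˡ (B i j))) ⟩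
  (1ℤ * B i j) * 1ℤ ∎
  where
  open ≡-Reasoning
  0≤Bik : 0ℤ ≤ B i k
  0≤Bik = subst (0ℤ ≤_) (sym (skew k i)) (neg-mono-≤ (sink i))

unit-conj-involutive : ∀ ε δ x y → ε * ε ≡ 1ℤ → δ * δ ≡ 1ℤ → (ε * x) * δ ≡ y → (ε * y) * δ ≡ x
unit-conj-involutive ε δ x y ε²≡1 δ²≡1 refl = begin
  (ε * ((ε * x) * δ)) * δ ≡⟨ regroup ε x δ ⟩
  ((ε * ε) * x) * (δ * δ) ≡⟨ cong₂ (λ s t → (s * x) * t) ε²≡1 δ²≡1 ⟩
  (1ℤ * x) * 1ℤ           ≡⟨ trans (*-identityʳ _) (*-identityˡ x) ⟩
  x ∎
  where
  open ≡-Reasoning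
  regroup : ∀ ε x δ → (ε * ((ε * x) * δ)) * δ ≡ ((ε * ε) * x) * (δ * δ)
  regroup = solve-∀

mainTheorem1 : (n : ℕ) (B : Mat (suc n)) → SkewSymmetric B → IsSink B zero →
    ((mutate zero B ≐ ρ n ⊗ B ⊗ ρ⁻¹ n) → (τ n ⊗ B ⊗ τ⁻¹ n ≐ B)) ×
    ((τ n ⊗ B ⊗ τ⁻¹ n ≐ B) → (mutate zero B ≐ ρ n ⊗ B ⊗ ρ⁻¹ n))
mainTheorem1 n B skew sink = period-1⇒τ-invariant , τ-invariant⇒period-1
  where
  s : Fin (suc n) → ℤ
  s = scaleAt (- 1ℤ) zero

  flip : ∀ i j x y → (s i * x) * s j ≡ y → (s i * y) * s j ≡ x
  flip i j x y = unit-conj-involutive (s i) (s j) x y (scaleAt-square zero i refl) (scaleAt-square zero j refl)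

  period-1⇒τ-invariant : (mutate zero B ≐ ρ n ⊗ B ⊗ ρ⁻¹ n) → (τ n ⊗ B ⊗ τ⁻¹ n ≐ B)
  period-1⇒τ-invariant period i j = trans (τ-conj n B i j) (flip i j _ _
    (trans (sym (mutate-sink B zero skew sink i j)) (trans (period i j) (ρ-conj n B i j))))

  τ-invariant⇒period-1 : (τ n ⊗ B ⊗ τ⁻¹ n ≐ B) → (mutate zero B ≐ ρ n ⊗ B ⊗ ρ⁻¹ n)
  τ-invariant⇒period-1 invariant i j = trans (mutate-sink B zero skew sink i j)
    (trans (flip i j _ _ (trans (sym (τ-conj n B i j)) (invariant i j))) (sym (ρ-conj n B i j)))
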